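{- Let $q=p^r$ be a prime power with $p\ge 5$ and $q\ne 7$. For every $g\in\mathcal{T}_q$ and $s\in(\mathbb{Z}/q\mathbb{Z})^\times$, $g\circ\theta_s=g$ if and only if $s=1$.
   Context: $\mathcal{T}_q$ is the set of functions $g:(\mathbb{Z}/q\mathbb{Z})^\times\to\{0,1\}$ such that $g(a)+g(-a)=1$ for all $a$, and $g(a)=0$ for every $a$ whose representative in $\{1,\dots,q-1\}$ is less than $q/3$. For $s\in(\mathbb{Z}/q\mathbb{Z})^\times$, $\theta_s$ denotes multiplication by $s$. -}

module Defs where

open import Data.Nat using (ℕ; _+_; _*_; _∸_; _≤_; _<_; NonZero)
open import Data.Nat.DivMod using (_%_)
open import Data.Nat.Coprimality using (Coprime)
open import Data.Fin using (Fin; toℕ)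
open import Data.Product using (_×_)
open import Relation.Binary.PropositionalEquality using (_≡_)

-- Elements of (ℤ/qℤ)^× are represented by their canonical representatives
-- a ∈ {1, …, q-1} with gcd(a, q) = 1.
IsUnit : ℕ → ℕ → Set
IsUnit q a = (1 ≤ a) × (a < q) × Coprime a q

neg : ℕ → ℕ → ℕ
neg q a = q ∸ a

θ : (q : ℕ) → .{{_ : NonZero q}} → ℕ → ℕ → ℕ
θ q s a = (s * a) % q

-- g : (ℤ/qℤ)^× → {0,1}, encoded as a function on representatives with values
-- in Fin 2; only its values on units matter.
-- g ∈ 𝒯_q :
InT : (q : ℕ) → (ℕ → Fin 2) → Set
InT q g =
  (∀ a → IsUnit q a → toℕ (g a) + toℕ (g (neg q a)) ≡ 1) ×
  (∀ a → IsUnit q a → 3 * a < q → toℕ (g a) ≡ 0)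

Invariant : (q : ℕ) → .{{_ : NonZero q}} → (ℕ → Fin 2) → ℕ → Set
Invariant q g s = ∀ a → IsUnit q a → g (θ q s a) ≡ g a

-- A function g ∈ 𝒯_q vanishes on the units a < q/3 and, since g(-a) = 1 - g(a), equals 1 on the
-- units above 2q/3. If g ∘ θ_s = g, then g is also invariant under θ_{s²} and θ_{s⁻¹}, so it
-- suffices to exhibit, for every unit s ≠ 1, some u in the subgroup generated by s and a unit
-- a < q/3 with u·a mod q > 2q/3. For q ≥ 19 such a pair is found by locating s in [1, q): above
-- 2q/3 take a = 1; in (q/3, q/2) take a = 2; below q/3 (for s ≥ 3) walk along the multiples
-- s·a until they first exceed 2q/3; in (q/2, 2q/3) walk along the odd multiples, which advance
-- by 2s - q; the cases s = 2 and 2s = q + 1 reduce to s = 4. Because q is a power of a prime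
-- p ≥ 5, of two candidates a and a + 1 or a + 2 at least one is a unit, and q is not divisible by
-- 2 or 3. The finitely many moduli q < 19 are settled by exhaustive search.

module Submission where

open import Defs
open import Data.Nat
open import Data.Nat.Properties
open import Data.Nat.DivMod
open import Data.Nat.Divisibility
open import Data.Nat.Coprimality using (Coprime; coprime?; coprime-divisor; ¬0-coprimeTo-2+)
import Data.Nat.Coprimality as Coprime
open import Data.Nat.Primality using (Prime; prime⇒irreducible)
open import Data.Nat.Tactic.RingSolver using (solve)
open import Data.Fin using (Fin; toℕ)
open import Data.List using (_∷_; [])
open import Data.Product
open import Data.Sum
open import Data.Empty using (⊥-elim)
open import Function using (_∘_)
open import Function.Bundles using (_⇔_; mk⇔)
open import Relation.Binary using (tri<; tri≈; tri>)
open import Relation.Binary.PropositionalEquality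
open import Relation.Nullary
open import Relation.Nullary.Decidable using (True; toWitness; decidable-stable; _×-dec_; _⊎-dec_; _→-dec_)

≤-lit : ∀ {m n} {m≤n : True (m ≤? n)} → m ≤ n
≤-lit {m≤n = m≤n} = toWitness m≤n

coprime-*ʳ : ∀ {c m n} → Coprime c m → Coprime c n → Coprime c (m * n)
coprime-*ʳ cm cn {d} (d∣c , d∣mn) = cn (d∣c , coprime-divisor d⊥m d∣mn)
  where
  d⊥m : Coprime d _
  d⊥m (e∣d , e∣m) = cm (∣-trans e∣d d∣c , e∣m)

coprime-^ʳ : ∀ {c m} r → Coprime c m → Coprime c (m ^ r)
coprime-^ʳ zero    _  (_ , d∣1) = ∣1⇒≡1 d∣1
coprime-^ʳ (suc r) cm = coprime-*ʳ cm (coprime-^ʳ r cm)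

prime∤⇒coprime : ∀ {p c} → Prime p → ¬ p ∣ c → Coprime c p
prime∤⇒coprime p-prime p∤c (d∣c , d∣p) with prime⇒irreducible p-prime d∣p
... | inj₁ d≡1  = d≡1
... | inj₂ refl = contradiction d∣c p∤c

prime∤⇒coprime-^ : ∀ {p c} r → Prime p → ¬ p ∣ c → Coprime c (p ^ r)
prime∤⇒coprime-^ r p-prime p∤c = coprime-^ʳ r (prime∤⇒coprime p-prime p∤c)

∤-prime-power : ∀ {p k} r → Prime p → 1 < k → k < p → ¬ k ∣ p ^ r
∤-prime-power r p-prime 1<k k<p k∣p^r =
  <⇒≢ 1<k (sym (prime∤⇒coprime-^ r p-prime (>⇒∤ {{>-nonZero (<-trans z<s 1<k)}} k<p) (∣-refl , k∣p^r)))

∤-+ : ∀ {p a k} → p ∣ a → 0 < k → k < p → ¬ p ∣ a + k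
∤-+ p∣a 0<k k<p p∣a+k = >⇒∤ {{>-nonZero 0<k}} k<p (∣m+n∣m⇒∣n p∣a+k p∣a)

coprime-%ˡ : ∀ {x q} .{{_ : NonZero q}} → Coprime x q → Coprime (x % q) q
coprime-%ˡ x⊥q (d∣x%q , d∣q) = x⊥q (∣n∣m%n⇒∣m d∣q d∣x%q , d∣q)

coprime-∸ˡ : ∀ {b q} → b ≤ q → Coprime b q → Coprime (q ∸ b) q
coprime-∸ˡ {b} {q} b≤q b⊥q (d∣q∸b , d∣q) =
  b⊥q (∣m+n∣m⇒∣n (subst (_ ∣_) (sym (m∸n+n≡m b≤q)) d∣q) d∣q∸b , d∣q)

%-*ˡ : ∀ m n d .{{_ : NonZero d}} → ((m % d) * n) % d ≡ (m * n) % d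
%-*ˡ m n d = begin
  ((m % d) * n) % d             ≡⟨ %-distribˡ-* (m % d) n d ⟩
  ((m % d % d) * (n % d)) % d   ≡⟨ cong (λ x → (x * (n % d)) % d) (m%n%n≡m%n m d) ⟩
  ((m % d) * (n % d)) % d       ≡⟨ %-distribˡ-* m n d ⟨
  (m * n) % d                   ∎
  where open ≡-Reasoning

%-*ʳ : ∀ m n d .{{_ : NonZero d}} → (m * (n % d)) % d ≡ (m * n) % d
%-*ʳ m n d = begin
  (m * (n % d)) % d ≡⟨ cong (_% d) (*-comm m (n % d)) ⟩
  ((n % d) * m) % d ≡⟨ %-*ˡ n m d ⟩
  (n * m) % d       ≡⟨ cong (_% d) (*-comm n m) ⟩
  (m * n) % d       ∎
  where open ≡-Reasoning

progression-crosses : ∀ {e B T} → 0 < e → B ≤ T → ∃ λ c → B + c * e ≤ T × T < B + suc c * e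
progression-crosses {e} {B} {T} 0<e B≤T = c , below , above
  where
  open ≤-Reasoning
  instance _ = >-nonZero 0<e
  c = (T ∸ B) / e
  below : B + c * e ≤ T
  below = begin
    B + c * e   ≤⟨ +-monoʳ-≤ B (m/n*n≤m (T ∸ B) e) ⟩
    B + (T ∸ B) ≡⟨ m+[n∸m]≡n B≤T ⟩
    T           ∎
  above : T < B + suc c * e
  above = begin-strict
    T                         ≡⟨ m+[n∸m]≡n B≤T ⟨
    B + (T ∸ B)               ≡⟨ cong (B +_) (m≡m%n+[m/n]*n (T ∸ B) e) ⟩
    B + ((T ∸ B) % e + c * e) <⟨ +-monoʳ-< B (+-monoˡ-< (c * e) (m%n<n (T ∸ B) e)) ⟩
    B + (e + c * e)           ∎

module _ {q : ℕ} .{{_ : NonZero q}} where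

  θ-exact : ∀ {s a v} k → s * a ≡ v + k * q → v < q → θ q s a ≡ v
  θ-exact {s} {a} {v} k sa≡v+kq v<q = begin
    (s * a) % q     ≡⟨ cong (_% q) sa≡v+kq ⟩
    (v + k * q) % q ≡⟨ [m+kn]%n≡m%n v k q ⟩
    v % q           ≡⟨ m<n⇒m%n≡m v<q ⟩
    v               ∎
    where open ≡-Reasoning

  θ-identity : ∀ {a} → a < q → θ q 1 a ≡ a
  θ-identity {a} a<q = θ-exact {1} {a} 0 (trans (*-identityˡ a) (sym (+-identityʳ a))) a<q

  θ-∘ : ∀ s t a → θ q (θ q s t) a ≡ θ q s (θ q t a)
  θ-∘ s t a = begin
    ((s * t) % q * a) % q ≡⟨ %-*ˡ (s * t) a q ⟩
    (s * t * a) % q       ≡⟨ cong (_% q) (*-assoc s t a) ⟩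
    (s * (t * a)) % q     ≡⟨ %-*ʳ s (t * a) q ⟨
    (s * (t * a % q)) % q ∎
    where open ≡-Reasoning

  invariant-identity : ∀ g → Invariant q g 1
  invariant-identity g a (_ , a<q , _) = cong g (θ-identity a<q)

module _ {q : ℕ} .{{_ : NonZero q}} .{{_ : NonTrivial q}} where

  coprime⇒1≤ : ∀ {x} → Coprime x q → 1 ≤ x
  coprime⇒1≤ {zero}  0⊥q = ⊥-elim (¬0-coprimeTo-2+ {q} 0⊥q)
  coprime⇒1≤ {suc _} _   = s≤s z≤n

  θ-isUnit : ∀ {s a} → IsUnit q s → IsUnit q a → IsUnit q (θ q s a)
  θ-isUnit {s} {a} (_ , _ , s⊥q) (_ , _ , a⊥q) = coprime⇒1≤ sa⊥q , m%n<n (s * a) q , sa⊥q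
    where
    sa⊥q : Coprime (θ q s a) q
    sa⊥q = coprime-%ˡ (Coprime.sym (coprime-*ʳ (Coprime.sym s⊥q) (Coprime.sym a⊥q)))

  neg-isUnit : ∀ {a} → IsUnit q a → IsUnit q (neg q a)
  neg-isUnit (1≤a , a<q , a⊥q) = coprime⇒1≤ -a⊥q , ∸-monoʳ-< 1≤a (<⇒≤ a<q) , -a⊥q
    where -a⊥q = coprime-∸ˡ (<⇒≤ a<q) a⊥q

  3[q∸b]<q : ∀ {b} → b ≤ q → 2 * q < 3 * b → 3 * (q ∸ b) < q
  3[q∸b]<q {b} b≤q 2q<3b = +-cancelʳ-< (3 * b) _ _ (begin-strict
    3 * (q ∸ b) + 3 * b   ≡⟨ cong (_+ 3 * b) (*-distribˡ-∸ 3 q b) ⟩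
    3 * q ∸ 3 * b + 3 * b ≡⟨ m∸n+n≡m (*-monoʳ-≤ 3 b≤q) ⟩
    3 * q                 ≡⟨ solve (q ∷ []) ⟩
    q + 2 * q             <⟨ +-monoʳ-< q 2q<3b ⟩
    q + 3 * b             ∎)
    where open ≤-Reasoning

  InT⇒high≡1 : ∀ {g b} → InT q g → IsUnit q b → 2 * q < 3 * b → toℕ (g b) ≡ 1
  InT⇒high≡1 {g} {b} (g+g∘neg≡1 , g-low) ub@(_ , b<q , _) 2q<3b = begin
    toℕ (g b)                         ≡⟨ +-identityʳ _ ⟨
    toℕ (g b) + 0                     ≡⟨ cong (toℕ (g b) +_) g-neg≡0 ⟨
    toℕ (g b) + toℕ (g (neg q b))     ≡⟨ g+g∘neg≡1 b ub ⟩
    1                                 ∎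
    where
    open ≡-Reasoning
    g-neg≡0 : toℕ (g (neg q b)) ≡ 0
    g-neg≡0 = g-low (neg q b) (neg-isUnit ub) (3[q∸b]<q (<⇒≤ b<q) 2q<3b)

  invariant-∘ : ∀ {g s t} → IsUnit q t → Invariant q g s → Invariant q g t → Invariant q g (θ q s t)
  invariant-∘ {g} {s} {t} ut inv-s inv-t a ua = begin
    g (θ q (θ q s t) a) ≡⟨ cong g (θ-∘ s t a) ⟩
    g (θ q s (θ q t a)) ≡⟨ inv-s _ (θ-isUnit ut ua) ⟩
    g (θ q t a)         ≡⟨ inv-t a ua ⟩
    g a                 ∎
    where open ≡-Reasoning

  invariant-inverse : ∀ {g s t} → IsUnit q t → θ q s t ≡ 1 → Invariant q g s → Invariant q g t
  invariant-inverse {g} {s} {t} ut st≡1 inv-s a ua@(_ , a<q , _) = begin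
    g (θ q t a)         ≡⟨ inv-s _ (θ-isUnit ut ua) ⟨
    g (θ q s (θ q t a)) ≡⟨ cong g (θ-∘ s t a) ⟨
    g (θ q (θ q s t) a) ≡⟨ cong (λ u → g (θ q u a)) st≡1 ⟩
    g (θ q 1 a)         ≡⟨ cong g (θ-identity a<q) ⟩
    g a                 ∎
    where open ≡-Reasoning

Asymmetric : (q : ℕ) .{{_ : NonZero q}} → ℕ → Set
Asymmetric q s = ∀ g → InT q g → ¬ Invariant q g s

LowToHigh : (q : ℕ) .{{_ : NonZero q}} → ℕ → ℕ → Set
LowToHigh q s a = 3 * a < q × 2 * q < 3 * θ q s a × IsUnit q a

LowToHighBelow : (q : ℕ) .{{_ : NonZero q}} → ℕ → Set
LowToHighBelow q s = ∃ λ a → a < q × LowToHigh q s a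

-- θ_2 sends no unit below q/3 above 2q/3, so the square of s has to be tried as well.
SquareOrSelfLowToHigh : (q : ℕ) .{{_ : NonZero q}} → ℕ → Set
SquareOrSelfLowToHigh q s = LowToHighBelow q s ⊎ LowToHighBelow q (θ q s s)

module _ {q : ℕ} .{{_ : NonZero q}} .{{_ : NonTrivial q}} where

  lowToHigh⇒asymmetric : ∀ {s a} → IsUnit q s → LowToHigh q s a → Asymmetric q s
  lowToHigh⇒asymmetric {s} {a} us (low , high , ua) g g∈T@(_ , g-low) inv = 0≢1+n (begin
    0                  ≡⟨ g-low a ua low ⟨
    toℕ (g a)          ≡⟨ cong toℕ (inv a ua) ⟨
    toℕ (g (θ q s a))  ≡⟨ InT⇒high≡1 g∈T (θ-isUnit us ua) high ⟩
    1                  ∎)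
    where open ≡-Reasoning

  asymmetric-square : ∀ {s} → IsUnit q s → Asymmetric q (θ q s s) → Asymmetric q s
  asymmetric-square {s} us asym g g∈T inv = asym g g∈T (invariant-∘ {s = s} us inv inv)

  squareOrSelf⇒asymmetric : ∀ {s} → IsUnit q s → SquareOrSelfLowToHigh q s → Asymmetric q s
  squareOrSelf⇒asymmetric us (inj₁ (_ , _ , s-lowToHigh))  = lowToHigh⇒asymmetric us s-lowToHigh
  squareOrSelf⇒asymmetric us (inj₂ (_ , _ , s²-lowToHigh)) =
    asymmetric-square us (lowToHigh⇒asymmetric (θ-isUnit us us) s²-lowToHigh)

  asymmetric-inverse : ∀ {s t} → IsUnit q t → θ q s t ≡ 1 → Asymmetric q t → Asymmetric q s
  asymmetric-inverse {s} ut st≡1 asym g g∈T inv = asym g g∈T (invariant-inverse {s = s} ut st≡1 inv)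

lowToHigh? : (q : ℕ) .{{_ : NonZero q}} → ∀ s a → Dec (LowToHigh q s a)
lowToHigh? q s a = 3 * a <? q ×-dec 2 * q <? 3 * θ q s a ×-dec (1 ≤? a ×-dec a <? q ×-dec coprime? a q)

squareOrSelfLowToHigh? : (q : ℕ) .{{_ : NonZero q}} → ∀ s → Dec (SquareOrSelfLowToHigh q s)
squareOrSelfLowToHigh? q s = anyUpTo? (lowToHigh? q s) q ⊎-dec anyUpTo? (lowToHigh? q (θ q s s)) q

-- Indexed by q - 1, so that the modulus is visibly nonzero.
SmallModulusCheck : ℕ → Set
SmallModulusCheck q′ = 5 ≤ q → q ≢ 7 → ¬ 2 ∣ q → ¬ 3 ∣ q →
  ∀ {s} → s < q → IsUnit q s → s ≢ 1 → SquareOrSelfLowToHigh q s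
  where q = suc q′

smallModulusCheck? : ∀ q′ → Dec (SmallModulusCheck q′)
smallModulusCheck? q′ =
  5 ≤? q →-dec ¬? (q ≟ 7) →-dec ¬? (2 ∣? q) →-dec ¬? (3 ∣? q) →-dec
  allUpTo? (λ s → isUnit? s →-dec ¬? (s ≟ 1) →-dec squareOrSelfLowToHigh? q s) q
  where
  q = suc q′
  isUnit? : ∀ s → Dec (IsUnit q s)
  isUnit? s = 1 ≤? s ×-dec s <? q ×-dec coprime? s q

smallModuli : ∀ {q′} → q′ < 18 → SmallModulusCheck q′
smallModuli = toWitness {a? = allUpTo? smallModulusCheck? 18} _

small-asymmetric : ∀ {q s} .{{_ : NonZero q}} → q < 19 → 5 ≤ q → q ≢ 7 → ¬ 2 ∣ q → ¬ 3 ∣ q →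
                   IsUnit q s → s ≢ 1 → Asymmetric q s
small-asymmetric {suc q′} (s≤s q′<18) 5≤q q≢7 2∤q 3∤q us@(_ , s<q , _) s≢1 =
  squareOrSelf⇒asymmetric us (smallModuli q′<18 5≤q q≢7 2∤q 3∤q s<q us s≢1)
  where instance _ = n>1⇒nonTrivial (<-≤-trans ≤-lit 5≤q)

module PrimePowerModulus {p r q : ℕ} .{{_ : NonZero q}} (p-prime : Prime p) (5≤p : 5 ≤ p)
                         (q≡p^r : q ≡ p ^ r) (19≤q : 19 ≤ q) where

  ∤-small : ∀ {k} → 0 < k → k < 5 → ¬ p ∣ k
  ∤-small 0<k k<5 = >⇒∤ {{>-nonZero 0<k}} (<-≤-trans k<5 5≤p)

  *≢q : ∀ k m → 1 < k → k < 5 → k * m ≢ q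
  *≢q k m 1<k k<5 km≡q =
    ∤-prime-power r p-prime 1<k (<-≤-trans k<5 5≤p) (subst (k ∣_) (trans km≡q q≡p^r) (m∣m*n m))

  lit<q : ∀ k {k<19 : True (k <? 19)} → k < q
  lit<q k {k<19} = <-≤-trans (toWitness k<19) 19≤q

  instance
    q-nonTrivial : NonTrivial q
    q-nonTrivial = n>1⇒nonTrivial (lit<q 1)

  lit<2q : ∀ k {k<38 : True (k <? 38)} → k < 2 * q
  lit<2q k {k<38} = <-≤-trans (toWitness k<38) (*-monoʳ-≤ 2 19≤q)

  isUnit : ∀ {a} → 1 ≤ a → a < q → ¬ p ∣ a → IsUnit q a
  isUnit 1≤a a<q p∤a = 1≤a , a<q , subst (Coprime _) (sym q≡p^r) (prime∤⇒coprime-^ r p-prime p∤a)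

  lowToHigh-exact : ∀ {s a} v k → 1 ≤ a → ¬ p ∣ a → 3 * a < q →
                    s * a ≡ v + k * q → 3 * v < 3 * q → 2 * q < 3 * v → LowToHigh q s a
  lowToHigh-exact {s} {a} v k 1≤a p∤a 3a<q sa≡v+kq 3v<3q 2q<3v =
    3a<q , subst (λ x → 2 * q < 3 * x) (sym sa%q≡v) 2q<3v , isUnit 1≤a a<q p∤a
    where
    a<q : a < q
    a<q = ≤-<-trans (m≤m+n a (2 * a)) 3a<q
    sa%q≡v : θ q s a ≡ v
    sa%q≡v = θ-exact {s = s} {a = a} k sa≡v+kq (*-cancelˡ-< 3 v q 3v<3q)

  lowToHigh-above-two-thirds : ∀ s → 2 * q < 3 * s → s < q → LowToHigh q s 1
  lowToHigh-above-two-thirds s 2q<3s s<q =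
    lowToHigh-exact {s = s} s 0 ≤-refl (∤-small ≤-lit ≤-lit) (lit<q _)
      (trans (*-identityʳ s) (sym (+-identityʳ s))) (*-monoʳ-< 3 s<q) 2q<3s

  lowToHigh-middle-third : ∀ s → q < 3 * s → 2 * s < q → LowToHigh q s 2
  lowToHigh-middle-third s q<3s 2s<q =
    lowToHigh-exact {s = s} (2 * s) 0 ≤-lit (∤-small ≤-lit ≤-lit) (lit<q _)
      (trans (*-comm s 2) (sym (+-identityʳ _))) (*-monoʳ-< 3 2s<q) 2q<6s
    where
    open ≤-Reasoning
    2q<6s : 2 * q < 3 * (2 * s)
    2q<6s = begin-strict
      2 * q       <⟨ *-monoʳ-< 2 q<3s ⟩
      2 * (3 * s) ≡⟨ solve (s ∷ []) ⟩
      3 * (2 * s) ∎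

  -- c is the last index with 3·(c·s) ≤ 2q, so s·(c + 1) is the first multiple above 2q/3.
  -- If p ∣ c + 1 then c ≥ 4, which leaves room for one more step of size s < q/6.
  module MultiplesCrossing {s c : ℕ} (3≤s : 3 ≤ s) (3s<q : 3 * s < q)
                           (below : c * (3 * s) ≤ 2 * q) (above : 2 * q < suc c * (3 * s)) where

    private
      open ≤-Reasoning

      unreduced : ∀ a → s * a ≡ s * a + 0 * q
      unreduced a = sym (+-identityʳ (s * a))

      9c≤2q : c * 9 ≤ 2 * q
      9c≤2q = ≤-trans (*-monoʳ-≤ c (*-monoʳ-≤ 3 3≤s)) below

    lowToHigh-next : ¬ p ∣ suc c → LowToHigh q s (suc c)
    lowToHigh-next p∤c+1 =
      lowToHigh-exact {s = s} (s * suc c) 0 (s≤s z≤n) p∤c+1 3a<q (unreduced (suc c)) 3v<3q 2q<3v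
      where
      3a<q : 3 * suc c < q
      3a<q = *-cancelˡ-< 3 _ _ (begin-strict
        3 * (3 * suc c)      ≡⟨ solve (c ∷ []) ⟩
        9 + c * 9            ≤⟨ +-monoʳ-≤ 9 9c≤2q ⟩
        9 + 2 * q            <⟨ +-monoˡ-< (2 * q) (lit<q 9) ⟩
        q + 2 * q            ≡⟨ solve (q ∷ []) ⟩
        3 * q                ∎)
      3v<3q : 3 * (s * suc c) < 3 * q
      3v<3q = begin-strict
        3 * (s * suc c)      ≡⟨ solve (s ∷ c ∷ []) ⟩
        3 * s + c * (3 * s)  <⟨ +-monoˡ-< _ 3s<q ⟩
        q + c * (3 * s)      ≤⟨ +-monoʳ-≤ q below ⟩
        q + 2 * q            ≡⟨ solve (q ∷ []) ⟩
        3 * q                ∎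
      2q<3v : 2 * q < 3 * (s * suc c)
      2q<3v = begin-strict
        2 * q                <⟨ above ⟩
        suc c * (3 * s)      ≡⟨ solve (s ∷ c ∷ []) ⟩
        3 * (s * suc c)      ∎

    lowToHigh-after-next : p ∣ suc c → LowToHigh q s (2 + c)
    lowToHigh-after-next p∣c+1 =
      lowToHigh-exact {s = s} (s * (2 + c)) 0 (s≤s z≤n) p∤c+2 3a<q (unreduced (2 + c)) 3v<3q 2q<3v
      where
      p∤c+2 : ¬ p ∣ 2 + c
      p∤c+2 = subst (λ x → ¬ p ∣ x) (+-comm (suc c) 1) (∤-+ p∣c+1 ≤-lit (<-≤-trans ≤-lit 5≤p))
      6s<q : 2 * (3 * s) < q
      6s<q = ≤∧≢⇒< (*-cancelˡ-≤ 2 (begin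
        2 * (2 * (3 * s))    ≡⟨ solve (s ∷ []) ⟩
        4 * (3 * s)          ≤⟨ *-monoˡ-≤ (3 * s) (≤-pred (≤-trans 5≤p (∣⇒≤ p∣c+1))) ⟩
        c * (3 * s)          ≤⟨ below ⟩
        2 * q                ∎)) (*≢q 2 (3 * s) ≤-lit ≤-lit)
      3a<q : 3 * (2 + c) < q
      3a<q = *-cancelˡ-< 3 _ _ (begin-strict
        3 * (3 * (2 + c))    ≡⟨ solve (c ∷ []) ⟩
        18 + c * 9           ≤⟨ +-monoʳ-≤ 18 9c≤2q ⟩
        18 + 2 * q           <⟨ +-monoˡ-< (2 * q) (lit<q 18) ⟩
        q + 2 * q            ≡⟨ solve (q ∷ []) ⟩
        3 * q                ∎)
      3v<3q : 3 * (s * (2 + c)) < 3 * q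
      3v<3q = begin-strict
        3 * (s * (2 + c))          ≡⟨ solve (s ∷ c ∷ []) ⟩
        2 * (3 * s) + c * (3 * s)  <⟨ +-monoˡ-< _ 6s<q ⟩
        q + c * (3 * s)            ≤⟨ +-monoʳ-≤ q below ⟩
        q + 2 * q                  ≡⟨ solve (q ∷ []) ⟩
        3 * q                      ∎
      2q<3v : 2 * q < 3 * (s * (2 + c))
      2q<3v = begin-strict
        2 * q                <⟨ above ⟩
        suc c * (3 * s)      ≤⟨ *-monoˡ-≤ (3 * s) (n≤1+n (suc c)) ⟩
        (2 + c) * (3 * s)    ≡⟨ solve (s ∷ c ∷ []) ⟩
        3 * (s * (2 + c))    ∎

  lowToHigh-below-third : ∀ s → 3 ≤ s → 3 * s < q → ∃ (LowToHigh q s)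
  lowToHigh-below-third s 3≤s 3s<q with progression-crosses (≤-trans ≤-lit (*-monoʳ-≤ 3 3≤s)) (z≤n {2 * q})
  ... | c , below , above with p ∣? suc c
  ...   | no  p∤c+1 = suc c , MultiplesCrossing.lowToHigh-next 3≤s 3s<q below above p∤c+1
  ...   | yes p∣c+1 = 2 + c , MultiplesCrossing.lowToHigh-after-next 3≤s 3s<q below above p∣c+1

  -- Writing 2s = q + e, the odd multiple s·(1 + 2j) is s + j·e modulo q; c is the last index
  -- with 3·(s + c·e) ≤ 2q. If p ∣ 1 + 2(c + 1) then c ≥ 1, which leaves room for one more step.
  module OddMultiplesCrossing {s e c : ℕ} (2s≡q+e : 2 * s ≡ q + e) (3≤e : 3 ≤ e)
                              (below : 3 * s + c * (3 * e) ≤ 2 * q)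
                              (above : 2 * q < 3 * s + suc c * (3 * e)) where

    private
      open ≤-Reasoning

      odd-multiple : ∀ j → s * (1 + 2 * j) ≡ (s + j * e) + j * q
      odd-multiple j = begin-equality
        s * (1 + 2 * j)       ≡⟨ solve (s ∷ j ∷ []) ⟩
        s + j * (2 * s)       ≡⟨ cong (λ x → s + j * x) 2s≡q+e ⟩
        s + j * (q + e)       ≡⟨ solve (s ∷ j ∷ q ∷ e ∷ []) ⟩
        (s + j * e) + j * q   ∎

      room : 3 * e + 2 * (c * (3 * e)) ≤ q
      room = +-cancelˡ-≤ (3 * q) _ _ (begin
        3 * q + (3 * e + 2 * (c * (3 * e))) ≡⟨ solve (q ∷ c ∷ e ∷ []) ⟩
        3 * (q + e) + 2 * (c * (3 * e))     ≡⟨ cong (λ x → 3 * x + 2 * (c * (3 * e))) 2s≡q+e ⟨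
        3 * (2 * s) + 2 * (c * (3 * e))     ≡⟨ solve (s ∷ c ∷ e ∷ []) ⟩
        2 * (3 * s + c * (3 * e))           ≤⟨ *-monoʳ-≤ 2 below ⟩
        2 * (2 * q)                         ≡⟨ solve (q ∷ []) ⟩
        3 * q + q                           ∎)

      9+18c≤q : 9 + 2 * (c * 9) ≤ q
      9+18c≤q = ≤-trans (+-mono-≤ (*-monoʳ-≤ 3 3≤e) (*-monoʳ-≤ 2 (*-monoʳ-≤ c (*-monoʳ-≤ 3 3≤e)))) room

    lowToHigh-next : ¬ p ∣ 1 + 2 * suc c → LowToHigh q s (1 + 2 * suc c)
    lowToHigh-next p∤a =
      lowToHigh-exact {s = s} (s + suc c * e) (suc c) (s≤s z≤n) p∤a 3a<q (odd-multiple (suc c)) 3v<3q 2q<3v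
      where
      3e<q : 3 * e < q
      3e<q = ≤∧≢⇒< (≤-trans (m≤m+n (3 * e) _) room) (*≢q 3 e ≤-lit ≤-lit)
      3a<q : 3 * (1 + 2 * suc c) < q
      3a<q = *-cancelˡ-< 3 _ _ (begin-strict
        3 * (3 * (1 + 2 * suc c))     ≡⟨ solve (c ∷ []) ⟩
        18 + (9 + 2 * (c * 9))        ≤⟨ +-monoʳ-≤ 18 9+18c≤q ⟩
        18 + q                        <⟨ +-monoˡ-< q (lit<2q 18) ⟩
        2 * q + q                     ≡⟨ solve (q ∷ []) ⟩
        3 * q                         ∎)
      3v<3q : 3 * (s + suc c * e) < 3 * q
      3v<3q = begin-strict
        3 * (s + suc c * e)           ≡⟨ solve (s ∷ c ∷ e ∷ []) ⟩
        (3 * s + c * (3 * e)) + 3 * e ≤⟨ +-monoˡ-≤ (3 * e) below ⟩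
        2 * q + 3 * e                 <⟨ +-monoʳ-< (2 * q) 3e<q ⟩
        2 * q + q                     ≡⟨ solve (q ∷ []) ⟩
        3 * q                         ∎
      2q<3v : 2 * q < 3 * (s + suc c * e)
      2q<3v = begin-strict
        2 * q                         <⟨ above ⟩
        3 * s + suc c * (3 * e)       ≡⟨ solve (s ∷ c ∷ e ∷ []) ⟩
        3 * (s + suc c * e)           ∎

    lowToHigh-after-next : p ∣ 1 + 2 * suc c → LowToHigh q s (1 + 2 * (2 + c))
    lowToHigh-after-next p∣a =
      lowToHigh-exact {s = s} (s + (2 + c) * e) (2 + c) (s≤s z≤n) p∤a+2 3a<q (odd-multiple (2 + c)) 3v<3q 2q<3v
      where
      a+2≡ : (1 + 2 * suc c) + 2 ≡ 1 + 2 * (2 + c)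
      a+2≡ = solve (c ∷ [])
      p∤a+2 : ¬ p ∣ 1 + 2 * (2 + c)
      p∤a+2 = subst (λ x → ¬ p ∣ x) a+2≡ (∤-+ p∣a ≤-lit (<-≤-trans ≤-lit 5≤p))
      1≤c : 1 ≤ c
      1≤c = *-cancelˡ-≤ 2 (+-cancelˡ-≤ 3 _ _ (begin
        3 + 2 * 1                     ≤⟨ 5≤p ⟩
        p                             ≤⟨ ∣⇒≤ p∣a ⟩
        1 + 2 * suc c                 ≡⟨ solve (c ∷ []) ⟩
        3 + 2 * c                     ∎))
      6e<q : 2 * (3 * e) < q
      6e<q = begin-strict
        2 * (3 * e)                   <⟨ m<n+m _ (≤-trans ≤-lit (*-monoʳ-≤ 3 3≤e)) ⟩
        3 * e + 2 * (3 * e)           ≤⟨ +-monoʳ-≤ (3 * e) (*-monoʳ-≤ 2 (m≤n*m (3 * e) c {{>-nonZero 1≤c}})) ⟩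
        3 * e + 2 * (c * (3 * e))     ≤⟨ room ⟩
        q                             ∎
      3a<q : 3 * (1 + 2 * (2 + c)) < q
      3a<q = *-cancelˡ-< 3 _ _ (begin-strict
        3 * (3 * (1 + 2 * (2 + c)))   ≡⟨ solve (c ∷ []) ⟩
        36 + (9 + 2 * (c * 9))        ≤⟨ +-monoʳ-≤ 36 9+18c≤q ⟩
        36 + q                        <⟨ +-monoˡ-< q (lit<2q 36) ⟩
        2 * q + q                     ≡⟨ solve (q ∷ []) ⟩
        3 * q                         ∎)
      3v<3q : 3 * (s + (2 + c) * e) < 3 * q
      3v<3q = begin-strict
        3 * (s + (2 + c) * e)         ≡⟨ solve (s ∷ c ∷ e ∷ []) ⟩
        (3 * s + c * (3 * e)) + 2 * (3 * e) ≤⟨ +-monoˡ-≤ (2 * (3 * e)) below ⟩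
        2 * q + 2 * (3 * e)           <⟨ +-monoʳ-< (2 * q) 6e<q ⟩
        2 * q + q                     ≡⟨ solve (q ∷ []) ⟩
        3 * q                         ∎
      2q<3v : 2 * q < 3 * (s + (2 + c) * e)
      2q<3v = begin-strict
        2 * q                         <⟨ above ⟩
        3 * s + suc c * (3 * e)       ≤⟨ +-monoʳ-≤ (3 * s) (*-monoˡ-≤ (3 * e) (n≤1+n (suc c))) ⟩
        3 * s + (2 + c) * (3 * e)     ≡⟨ solve (s ∷ c ∷ e ∷ []) ⟩
        3 * (s + (2 + c) * e)         ∎

  lowToHigh-above-half : ∀ s {e} → 2 * s ≡ q + e → 3 ≤ e → 3 * s ≤ 2 * q → ∃ (LowToHigh q s)
  lowToHigh-above-half s 2s≡q+e 3≤e 3s≤2q with progression-crosses (≤-trans ≤-lit (*-monoʳ-≤ 3 3≤e)) 3s≤2q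
  ... | c , below , above with p ∣? 1 + 2 * suc c
  ...   | no  p∤a = 1 + 2 * suc c , OddMultiplesCrossing.lowToHigh-next {s = s} 2s≡q+e 3≤e below above p∤a
  ...   | yes p∣a = 1 + 2 * (2 + c) , OddMultiplesCrossing.lowToHigh-after-next {s = s} 2s≡q+e 3≤e below above p∣a

  isUnit-2 : IsUnit q 2
  isUnit-2 = isUnit ≤-lit (lit<q 2) (∤-small ≤-lit ≤-lit)

  asymmetric-2 : Asymmetric q 2
  asymmetric-2 = asymmetric-square isUnit-2 (subst (Asymmetric q) (sym 2·2≡4) asymmetric-4)
    where
    2·2≡4 : θ q 2 2 ≡ 4
    2·2≡4 = θ-exact {s = 2} {a = 2} 0 refl (lit<q 4)
    asymmetric-4 : Asymmetric q 4
    asymmetric-4 = lowToHigh⇒asymmetric (isUnit ≤-lit (lit<q 4) (∤-small ≤-lit ≤-lit))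
                                        (proj₂ (lowToHigh-below-third 4 ≤-lit (lit<q 12)))

  asymmetric-below-third : ∀ {s} → IsUnit q s → 1 < s → 3 * s < q → Asymmetric q s
  asymmetric-below-third {s} us 1<s 3s<q with s ≟ 2
  ... | yes refl = asymmetric-2
  ... | no  s≢2  = lowToHigh⇒asymmetric us (proj₂ (lowToHigh-below-third s (≤∧≢⇒< 1<s (s≢2 ∘ sym)) 3s<q))

  asymmetric-above-half : ∀ {s} e → IsUnit q s → 2 * s ≡ q + e → 3 * s ≤ 2 * q → Asymmetric q s
  asymmetric-above-half {s} 0 _ 2s≡q _ = ⊥-elim (*≢q 2 s ≤-lit ≤-lit (trans 2s≡q (+-identityʳ q)))
  asymmetric-above-half {s} 1 _ 2s≡q+1 _ = asymmetric-inverse {s = s} isUnit-2 s·2≡1 asymmetric-2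
    where
    s·2≡1 : θ q s 2 ≡ 1
    s·2≡1 = θ-exact {s = s} {a = 2} 1 (begin
      s * 2     ≡⟨ *-comm s 2 ⟩
      2 * s     ≡⟨ 2s≡q+1 ⟩
      q + 1     ≡⟨ solve (q ∷ []) ⟩
      1 + 1 * q ∎) (lit<q 1)
      where open ≡-Reasoning
  asymmetric-above-half {s} 2 _ 2s≡q+2 _ = ⊥-elim (*≢q 2 (s ∸ 1) ≤-lit ≤-lit (begin
    2 * (s ∸ 1)   ≡⟨ *-distribˡ-∸ 2 s 1 ⟩
    2 * s ∸ 2     ≡⟨ cong (_∸ 2) 2s≡q+2 ⟩
    q + 2 ∸ 2     ≡⟨ m+n∸n≡m q 2 ⟩
    q             ∎))
    where open ≡-Reasoning
  asymmetric-above-half {s} e@(suc (suc (suc _))) us 2s≡q+e 3s≤2q =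
    lowToHigh⇒asymmetric us (proj₂ (lowToHigh-above-half s 2s≡q+e ≤-lit 3s≤2q))

  asymmetric : ∀ {s} → IsUnit q s → s ≢ 1 → Asymmetric q s
  asymmetric {s} us@(1≤s , s<q , _) s≢1 with 2 * q <? 3 * s
  ... | yes 2q<3s = lowToHigh⇒asymmetric us (lowToHigh-above-two-thirds s 2q<3s s<q)
  ... | no  2q≮3s with <-cmp (3 * s) q
  ...   | tri< 3s<q _ _ = asymmetric-below-third us (≤∧≢⇒< 1≤s (s≢1 ∘ sym)) 3s<q
  ...   | tri≈ _ 3s≡q _ = ⊥-elim (*≢q 3 s ≤-lit ≤-lit 3s≡q)
  ...   | tri> _ _ q<3s with 2 * s <? q
  ...     | yes 2s<q = lowToHigh⇒asymmetric us (lowToHigh-middle-third s q<3s 2s<q)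
  ...     | no  2s≮q = asymmetric-above-half (2 * s ∸ q) us (sym (m+[n∸m]≡n (≮⇒≥ 2s≮q))) (≮⇒≥ 2q≮3s)

prime-power-asymmetric : ∀ {p r q s} .{{_ : NonZero q}} → Prime p → 1 ≤ r → q ≡ p ^ r → 5 ≤ p → q ≢ 7 →
                         IsUnit q s → s ≢ 1 → Asymmetric q s
prime-power-asymmetric {p} {r} {q} p-prime 1≤r q≡p^r 5≤p q≢7 us s≢1 with q <? 19
... | yes q<19 = small-asymmetric q<19 5≤q q≢7 (∤q ≤-lit ≤-lit) (∤q ≤-lit ≤-lit) us s≢1
  where
  5≤q : 5 ≤ q
  5≤q = begin
    5     ≤⟨ 5≤p ⟩
    p     ≡⟨ ^-identityʳ p ⟨
    p ^ 1 ≤⟨ ^-monoʳ-≤ p {{>-nonZero (<-≤-trans ≤-lit 5≤p)}} 1≤r ⟩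
    p ^ r ≡⟨ q≡p^r ⟨
    q     ∎
    where open ≤-Reasoning
  ∤q : ∀ {k} → 1 < k → k < 5 → ¬ k ∣ q
  ∤q {k} 1<k k<5 = subst (λ x → ¬ k ∣ x) (sym q≡p^r) (∤-prime-power r p-prime 1<k (<-≤-trans k<5 5≤p))
... | no  q≮19 = PrimePowerModulus.asymmetric {r = r} p-prime 5≤p q≡p^r (≮⇒≥ q≮19) us s≢1

corollary5p7 : (p r q : ℕ) → .{{_ : NonZero q}} → Prime p → 1 ≤ r → q ≡ p ^ r
    → 5 ≤ p → q ≢ 7
    → (g : ℕ → Fin 2) → InT q g
    → (s : ℕ) → IsUnit q s
    → Invariant q g s ⇔ s ≡ 1
corollary5p7 p r q p-prime 1≤r q≡p^r 5≤p q≢7 g g∈T s us = mk⇔ invariant⇒≡1 ≡1⇒invariant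
  where
  invariant⇒≡1 : Invariant q g s → s ≡ 1
  invariant⇒≡1 inv = decidable-stable (s ≟ 1) λ s≢1 →
    prime-power-asymmetric p-prime 1≤r q≡p^r 5≤p q≢7 us s≢1 g g∈T inv
  ≡1⇒invariant : s ≡ 1 → Invariant q g s
  ≡1⇒invariant refl = invariant-identity g
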